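{- Let $\mathsf{L}^{\mathsf{A}}$ be a logic and $\mathsf{CS}$ a constant specification as in the context, and let $\mathcal{M}^C=(W^C,W^C_0,V^C,E^C)$ be the canonical model for $\mathsf{L}^{\mathsf{A}}_{\mathsf{CS}}$. If $\mathsf{L}^{\mathsf{A}}$ does not contain (jd), or contains (jd) and either $\mathsf{CS}$ is axiomatically appropriate or (jt) is also in $\mathsf{L}^{\mathsf{A}}$, then $\mathcal{M}^C$ is an $\mathsf{L}^{\mathsf{A}}_{\mathsf{CS}}$-subset model.
   Context: Terms $\mathsf{Tm}^{\mathsf{A}}$: $t::=c_i\mid x_i\mid (t\cdot t)\mid(t+t)\mid\ !t$. Formulas $\mathcal{L}^{\mathsf{A}}_J$: $F::=p_i\mid\bot\mid F\to F\mid t:F$. Axiom schemes: (cl) all classical propositional axioms; (j) $s:(A\to B)\to(t:A\to s\cdot t:B)$; (j+) $s:A\lor t:A\to(s+t):A$; (j4) $t:A\to\ !t:(t:A)$; (jd) $t:\bot\to\bot$; (jt) $t:A\to A$. A logic $\mathsf{L}^{\mathsf{A}}$: (cl),(j),(j+) plus some subset of $\{$(j4),(jd),(jt)$\}$. A constant specification $\mathsf{CS}$: set of pairs $(c,A)$, $c$ a constant, $A$ an axiom of $\mathsf{L}^{\mathsf{A}}$; axiomatically appropriate if each axiom $A$ has some $c$ with $(c,A)\in\mathsf{CS}$. $\mathsf{L}^{\mathsf{A}}_{\mathsf{CS}}$: Hilbert system with these axioms, modus ponens and axiom necessitation (for $(c,A)\in\mathsf{CS}$, $n\ge0$ infer $!^nc:\,!^{n-1}c:\cdots:\,!c:c:A$,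 $!^kc$ being $c$ preceded by $k$ copies of $!$). A set $\Gamma$ is $\mathsf{L}^{\mathsf{A}}_{\mathsf{CS}}$-consistent if $\mathsf{L}^{\mathsf{A}}_{\mathsf{CS}}\nvdash\bigwedge\Sigma\to\bot$ for all finite $\Sigma\subseteq\Gamma$; maximal consistent if consistent and no proper superset is. Canonical model: $W^C=\mathcal{P}(\mathcal{L}^{\mathsf{A}}_J)$; $W^C_0$ = maximal $\mathsf{L}^{\mathsf{A}}_{\mathsf{CS}}$-consistent sets; $V^C(\Gamma,F)=1$ iff $F\in\Gamma$; $E^C(\Gamma,t)=\{\Delta\in W^C:\Delta\supseteq\Gamma/t\}$ where $\Gamma/t=\{F:t:F\in\Gamma\}$. An $\mathsf{L}^{\mathsf{A}}_{\mathsf{CS}}$-subset model is $(W,W_0,V,E)$ with $W$ a set, $\emptyset\ne W_0\subseteq W$, $V:W\times\mathcal{L}^{\mathsf{A}}_J\to\{0,1\}$, $E:W\times\mathsf{Tm}^{\mathsf{A}}\to\mathcal{P}(W)$ such that, with $[A]=\{\upsilon:V(\upsilon,A)=1\}$ and $\mathsf{APP}_\omega(s,t)=\{F:\exists H\,(E(\omega,s)\subseteq[H\to F]$ and $E(\omega,t)\subseteq[H])\}$, for all $\omega\in W_0$, $s,t$, $F,G$: $V(\omega,\bot)=0$; $V(\omega,F\to G)=1$ iff $V(\omega,F)=0$ or $V(\omega,G)=1$; $V(\omega,t:F)=1$ iff $E(\omega,t)\subseteq[F]$; $E(\omega,s\cdot t)\subseteq\{\upsilon:\upsilon\in[F]$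 for all $F\in\mathsf{APP}_\omega(s,t)\}$; $E(\omega,s+t)\subseteq E(\omega,s)\cap E(\omega,t)$; if (jd)$\in\mathsf{L}^{\mathsf{A}}$ some $\upsilon\in W_0$ is in $E(\omega,t)$; if (jt)$\in\mathsf{L}^{\mathsf{A}}$ then $\omega\in E(\omega,t)$; if (j4)$\in\mathsf{L}^{\mathsf{A}}$ then $E(\omega,!t)\subseteq\{\upsilon:\forall F\,(V(\omega,t:F)=1\Rightarrow V(\upsilon,t:F)=1)\}$; for $(c,A)\in\mathsf{CS}$, $n\ge1$: $E(\omega,c)\subseteq[A]$ and $E(\omega,!^nc)\subseteq[!^{n-1}c:\cdots:\,!c:c:A]$. -}

module Defs where

open import Data.Nat using (ℕ; zero; suc)
open import Data.Bool using (Bool; true; false)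
open import Data.List using (List; []; _∷_)
open import Data.List.Relation.Unary.All using (All)
open import Data.Product using (Σ; _×_; _,_)
open import Data.Sum using (_⊎_)
open import Relation.Binary.PropositionalEquality using (_≡_)
open import Relation.Nullary using (¬_)

infixr 6 _⇒_
infix  7 _∶_
infixl 9 _·_
infixl 8 _+ₜ_

data Tm : Set where
  cst   : ℕ → Tm
  var   : ℕ → Tm
  _·_   : Tm → Tm → Tm
  _+ₜ_  : Tm → Tm → Tm
  !_    : Tm → Tm

data Fm : Set where
  atom : ℕ → Fm
  ⊥'   : Fm
  _⇒_  : Fm → Fm → Fm
  _∶_  : Tm → Fm → Fm

¬' : Fm → Fm
¬' A = A ⇒ ⊥'

⊤' : Fm
⊤' = ⊥' ⇒ ⊥'

_∨'_ : Fm → Fm → Fm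
A ∨' B = ¬' A ⇒ B

_∧'_ : Fm → Fm → Fm
A ∧' B = ¬' (A ⇒ ¬' B)

⋀ : List Fm → Fm
⋀ []      = ⊤'
⋀ (A ∷ Σ) = A ∧' ⋀ Σ

bang : ℕ → Tm → Tm
bang zero    t = t
bang (suc n) t = ! (bang n t)

-- necF c A n  =  !^n c : !^(n-1) c : ... : ! c : c : A
necF : ℕ → Fm → ℕ → Fm
necF c A zero    = cst c ∶ A
necF c A (suc n) = bang (suc n) (cst c) ∶ necF c A n

-- Logics L^A : (cl), (j), (j+) plus a chosen subset of {(j4),(jd),(jt)}

record Logic : Set where
  field
    hasJ4 : Bool
    hasJD : Bool
    hasJT : Bool
open Logic public

-- Axioms of L^A.  (cl) is given by a standard complete Hilbert
-- axiomatisation of classical propositional logic in ⊥, → (K, S, DNE).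
data Axiom (L : Logic) : Fm → Set where
  cl-K   : ∀ A B → Axiom L (A ⇒ (B ⇒ A))
  cl-S   : ∀ A B C → Axiom L ((A ⇒ (B ⇒ C)) ⇒ ((A ⇒ B) ⇒ (A ⇒ C)))
  cl-DNE : ∀ A → Axiom L (¬' (¬' A) ⇒ A)
  j      : ∀ s t A B → Axiom L ((s ∶ (A ⇒ B)) ⇒ ((t ∶ A) ⇒ (s · t ∶ B)))
  j+     : ∀ s t A → Axiom L (((s ∶ A) ∨' (t ∶ A)) ⇒ (s +ₜ t ∶ A))
  j4     : hasJ4 L ≡ true → ∀ t A → Axiom L ((t ∶ A) ⇒ (! t ∶ (t ∶ A)))
  jd     : hasJD L ≡ true → ∀ t → Axiom L ((t ∶ ⊥') ⇒ ⊥')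
  jt     : hasJT L ≡ true → ∀ t A → Axiom L ((t ∶ A) ⇒ A)

record CS (L : Logic) : Set₁ where
  field
    _∋ᶜ_ : ℕ → Fm → Set
    onlyAxioms : ∀ c A → _∋ᶜ_ c A → Axiom L A
open CS public

AxiomaticallyAppropriate : ∀ {L} → CS L → Set
AxiomaticallyAppropriate {L} cs = ∀ A → Axiom L A → Σ ℕ λ c → _∋ᶜ_ cs c A

data Prf (L : Logic) (cs : CS L) : Fm → Set where
  ax  : ∀ {A} → Axiom L A → Prf L cs A
  mp  : ∀ {A B} → Prf L cs (A ⇒ B) → Prf L cs A → Prf L cs B
  nec : ∀ {c A} → _∋ᶜ_ cs c A → (n : ℕ) → Prf L cs (necF c A n)

FmSet : Set
FmSet = Fm → Bool

_∈ˢ_ : Fm → FmSet → Set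
F ∈ˢ Γ = Γ F ≡ true

_⊆ˢ_ : FmSet → FmSet → Set
Γ ⊆ˢ Δ = ∀ F → F ∈ˢ Γ → F ∈ˢ Δ

Consistent : (L : Logic) → CS L → FmSet → Set
Consistent L cs Γ = ∀ (Σ : List Fm) → All (λ F → F ∈ˢ Γ) Σ → ¬ Prf L cs (⋀ Σ ⇒ ⊥')

MaxConsistent : (L : Logic) → CS L → FmSet → Set
MaxConsistent L cs Γ =
  Consistent L cs Γ × (∀ Δ → Γ ⊆ˢ Δ → Consistent L cs Δ → Δ ⊆ˢ Γ)

module _ {W : Set} (V : W → Fm → Bool) (E : W → Tm → W → Set) where

  ⟦_⟧ : Fm → W → Set
  ⟦ A ⟧ υ = V υ A ≡ true

  _⊆E_ : (W → Set) → (W → Set) → Set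
  X ⊆E Y = ∀ υ → X υ → Y υ

  APP : W → Tm → Tm → Fm → Set
  APP ω s t F = Σ Fm λ H → (E ω s ⊆E ⟦ H ⇒ F ⟧) × (E ω t ⊆E ⟦ H ⟧)

record IsSubsetModel (L : Logic) (cs : CS L) (W : Set) (W₀ : W → Set)
                     (V : W → Fm → Bool) (E : W → Tm → W → Set) : Set₁ where
  field
    W₀-nonempty : Σ W W₀
    V-⊥   : ∀ ω → W₀ ω → V ω ⊥' ≡ false
    V-⇒₁  : ∀ ω → W₀ ω → ∀ F G → V ω (F ⇒ G) ≡ true → (V ω F ≡ false ⊎ V ω G ≡ true)
    V-⇒₂  : ∀ ω → W₀ ω → ∀ F G → (V ω F ≡ false ⊎ V ω G ≡ true) → V ω (F ⇒ G) ≡ true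
    V-∶₁  : ∀ ω → W₀ ω → ∀ t F → V ω (t ∶ F) ≡ true → _⊆E_ V E (E ω t) (⟦_⟧ V E F)
    V-∶₂  : ∀ ω → W₀ ω → ∀ t F → _⊆E_ V E (E ω t) (⟦_⟧ V E F) → V ω (t ∶ F) ≡ true
    E-·   : ∀ ω → W₀ ω → ∀ s t →
              _⊆E_ V E (E ω (s · t)) (λ υ → ∀ F → APP V E ω s t F → ⟦_⟧ V E F υ)
    E-+   : ∀ ω → W₀ ω → ∀ s t →
              _⊆E_ V E (E ω (s +ₜ t)) (λ υ → E ω s υ × E ω t υ)
    E-jd  : hasJD L ≡ true → ∀ ω → W₀ ω → ∀ t → Σ W λ υ → W₀ υ × E ω t υ
    E-jt  : hasJT L ≡ true → ∀ ω → W₀ ω → ∀ t → E ω t ω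
    E-j4  : hasJ4 L ≡ true → ∀ ω → W₀ ω → ∀ t →
              _⊆E_ V E (E ω (! t)) (λ υ → ∀ F → V ω (t ∶ F) ≡ true → V υ (t ∶ F) ≡ true)
    E-cs  : ∀ ω → W₀ ω → ∀ c A → _∋ᶜ_ cs c A → _⊆E_ V E (E ω (cst c)) (⟦_⟧ V E A)
    E-cs! : ∀ ω → W₀ ω → ∀ c A → _∋ᶜ_ cs c A → ∀ (n : ℕ) →
              _⊆E_ V E (E ω (bang (suc n) (cst c))) (⟦_⟧ V E (necF c A n))

Wᶜ : Set
Wᶜ = FmSet

W₀ᶜ : (L : Logic) → CS L → Wᶜ → Set
W₀ᶜ L cs Γ = MaxConsistent L cs Γ

Vᶜ : Wᶜ → Fm → Bool
Vᶜ Γ F = Γ F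

Eᶜ : Wᶜ → Tm → Wᶜ → Set
Eᶜ Γ t Δ = ∀ F → (t ∶ F) ∈ˢ Γ → F ∈ˢ Δ

-- Maximal consistent sets are closed under the axioms and modus ponens, so each closure
-- condition on E^C is an instance of the matching axiom read through Γ/t = {F : t:F ∈ Γ};
-- and since W^C contains every set of formulas, Γ/t itself lies in E^C(Γ,t), which gives
-- the truth condition for t:F. The only existence claim is seriality under (jd). With (jt),
-- Γ is its own witness. Otherwise axiomatic appropriateness lifts a derivation of ⊥ from
-- Γ/t to some s:⊥ ∈ Γ, which (jd) forbids; so Γ/t is consistent, and Lindenbaum's lemma
-- (formulas are countable, and excluded middle decides consistency) extends it to a
-- maximal consistent set.
module Submission where

open import Defs
open import Level using (0ℓ)
open import Data.Bool using (true; false; if_then_else_)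
open import Data.Bool.Properties using (not-¬)
open import Data.Empty using (⊥)
open import Data.Unit using (⊤)
open import Data.List using (List; []; _∷_)
open import Data.List.Membership.Propositional using (_∈_)
open import Data.List.Relation.Binary.Subset.Propositional using (_⊆_)
open import Data.List.Relation.Binary.Subset.Propositional.Properties
  using (⊆-trans; ∷⁺ʳ; ∈-∷⁺ʳ; xs⊆x∷xs; xs⊆xs++ys; xs⊆ys++xs)
open import Data.List.Relation.Unary.All as All using (All; []; _∷_)
open import Data.List.Relation.Unary.All.Properties using (++⁺)
open import Data.List.Relation.Unary.Any using (here; there)
open import Data.Maybe using (Maybe; just; nothing; map; zipWith)
open import Data.Maybe.Properties using (just-injective)
open import Data.Nat using (ℕ; zero; suc; _+_; _⊔_; _≤′_; ≤′-refl; ≤′-step)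
open import Data.Nat.Properties using (+-suc; +-identityʳ; suc-injective; ≤⇒≤′; m≤m⊔n; m≤n⊔m)
open import Data.Product using (∃-syntax; _×_; _,_; proj₁; proj₂)
open import Data.Sum using (_⊎_; inj₁; inj₂)
open import Data.Tree.Binary using (Tree; leaf; node)
open import Function using (_∘_)
open import Relation.Binary.PropositionalEquality using (_≡_; refl; sym; trans; cong; cong₂)
open import Relation.Nullary using (¬_; yes; no; does; contradiction)
open import Relation.Nullary.Decidable using (dec-true; decidable-stable)
open import Axiom.ExcludedMiddle using (ExcludedMiddle)

-- Cantor's enumeration of ℕ × ℕ along the diagonals; pair a b is an index reaching (a , b).
next : ℕ × ℕ → ℕ × ℕ
next (zero  , b) = suc b , zero
next (suc a , b) = a , suc b

unpair : ℕ → ℕ × ℕ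
unpair zero    = 0 , 0
unpair (suc n) = next (unpair n)

unpair-onto-diagonal : ∀ d a b → a + b ≡ d → ∃[ n ] unpair n ≡ (a , b)
unpair-onto-diagonal d       a       (suc b) eq =
  let n , e = unpair-onto-diagonal d (suc a) b (trans (sym (+-suc a b)) eq) in suc n , cong next e
unpair-onto-diagonal d       zero    zero    _  = 0 , refl
unpair-onto-diagonal zero    (suc a) zero    ()
unpair-onto-diagonal (suc d) (suc a) zero    eq =
  let n , e = unpair-onto-diagonal d zero a (trans (sym (+-identityʳ a)) (suc-injective eq)) in suc n , cong next e

pair : ℕ → ℕ → ℕ
pair a b = proj₁ (unpair-onto-diagonal (a + b) a b refl)

unpair-pair : ∀ a b → unpair (pair a b) ≡ (a , b)
unpair-pair a b = proj₂ (unpair-onto-diagonal (a + b) a b refl)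

pair-injective : ∀ a b c d → pair a b ≡ pair c d → a ≡ c × b ≡ d
pair-injective a b c d e =
  let same = trans (sym (unpair-pair a b)) (trans (cong unpair e) (unpair-pair c d))
  in cong proj₁ same , cong proj₂ same

treeCode : Tree ℕ ℕ → ℕ
treeCode (leaf i)     = pair 0 i
treeCode (node l n r) = pair (suc n) (pair (treeCode l) (treeCode r))

treeCode-injective : ∀ x y → treeCode x ≡ treeCode y → x ≡ y
treeCode-injective (leaf i) (leaf i′) e = cong leaf (proj₂ (pair-injective 0 i 0 i′ e))
treeCode-injective (leaf i) (node l n r) e
  with () ← proj₁ (pair-injective 0 i (suc n) (pair (treeCode l) (treeCode r)) e)
treeCode-injective (node l n r) (leaf i) e
  with () ← proj₁ (pair-injective (suc n) (pair (treeCode l) (treeCode r)) 0 i e)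
treeCode-injective (node l n r) (node l′ n′ r′) e
  with tag , children ←
    pair-injective (suc n) (pair (treeCode l) (treeCode r)) (suc n′) (pair (treeCode l′) (treeCode r′)) e
  with left , right ← pair-injective (treeCode l) (treeCode r) (treeCode l′) (treeCode r′) children
  with refl ← suc-injective tag
     | refl ← treeCode-injective l l′ left
     | refl ← treeCode-injective r r′ right = refl

leafLabel : Tree ℕ ℕ → Maybe ℕ
leafLabel (leaf i)     = just i
leafLabel (node _ _ _) = nothing

tmTree : Tm → Tree ℕ ℕ
tmTree (cst i)  = node (leaf i) 0 (leaf 0)
tmTree (var i)  = node (leaf i) 1 (leaf 0)
tmTree (s · t)  = node (tmTree s) 2 (tmTree t)
tmTree (s +ₜ t) = node (tmTree s) 3 (tmTree t)
tmTree (! t)    = node (tmTree t) 4 (leaf 0)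

tmFromTree : Tree ℕ ℕ → Maybe Tm
tmFromTree (node l 0 _) = map cst (leafLabel l)
tmFromTree (node l 1 _) = map var (leafLabel l)
tmFromTree (node l 2 r) = zipWith _·_ (tmFromTree l) (tmFromTree r)
tmFromTree (node l 3 r) = zipWith _+ₜ_ (tmFromTree l) (tmFromTree r)
tmFromTree (node l 4 _) = map !_ (tmFromTree l)
tmFromTree _            = nothing

tmFromTree-tmTree : ∀ t → tmFromTree (tmTree t) ≡ just t
tmFromTree-tmTree (cst i)  = refl
tmFromTree-tmTree (var i)  = refl
tmFromTree-tmTree (s · t)  = cong₂ (zipWith _·_) (tmFromTree-tmTree s) (tmFromTree-tmTree t)
tmFromTree-tmTree (s +ₜ t) = cong₂ (zipWith _+ₜ_) (tmFromTree-tmTree s) (tmFromTree-tmTree t)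
tmFromTree-tmTree (! t)    = cong (map !_) (tmFromTree-tmTree t)

fmTree : Fm → Tree ℕ ℕ
fmTree (atom i) = node (leaf i) 0 (leaf 0)
fmTree ⊥'       = leaf 0
fmTree (A ⇒ B)  = node (fmTree A) 1 (fmTree B)
fmTree (t ∶ A)  = node (tmTree t) 2 (fmTree A)

fmFromTree : Tree ℕ ℕ → Maybe Fm
fmFromTree (leaf _)     = just ⊥'
fmFromTree (node l 0 _) = map atom (leafLabel l)
fmFromTree (node l 1 r) = zipWith _⇒_ (fmFromTree l) (fmFromTree r)
fmFromTree (node l 2 r) = zipWith _∶_ (tmFromTree l) (fmFromTree r)
fmFromTree _            = nothing

fmFromTree-fmTree : ∀ A → fmFromTree (fmTree A) ≡ just A
fmFromTree-fmTree (atom i) = refl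
fmFromTree-fmTree ⊥'       = refl
fmFromTree-fmTree (A ⇒ B)  = cong₂ (zipWith _⇒_) (fmFromTree-fmTree A) (fmFromTree-fmTree B)
fmFromTree-fmTree (t ∶ A)  = cong₂ (zipWith _∶_) (tmFromTree-tmTree t) (fmFromTree-fmTree A)

code : Fm → ℕ
code = treeCode ∘ fmTree

code-injective : ∀ {A B} → code A ≡ code B → A ≡ B
code-injective {A} {B} e = just-injective (trans (sym (fmFromTree-fmTree A))
  (trans (cong fmFromTree (treeCode-injective (fmTree A) (fmTree B) e)) (fmFromTree-fmTree B)))

module Hilbert (L : Logic) (cs : CS L) where

  infix 3 _⊢_

  data _⊢_ (Φ : List Fm) : Fm → Set where
    hyp : ∀ {A} → A ∈ Φ → Φ ⊢ A
    thm : ∀ {A} → Prf L cs A → Φ ⊢ A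
    mp  : ∀ {A B} → Φ ⊢ A ⇒ B → Φ ⊢ A → Φ ⊢ B

  ⇒-refl : ∀ A → Prf L cs (A ⇒ A)
  ⇒-refl A = mp (mp (ax (cl-S A (A ⇒ A) A)) (ax (cl-K A (A ⇒ A)))) (ax (cl-K A A))

  closed : ∀ {A} → [] ⊢ A → Prf L cs A
  closed (hyp ())
  closed (thm p)  = p
  closed (mp d e) = mp (closed d) (closed e)

  weaken : ∀ {Φ Ψ A} → Φ ⊆ Ψ → Φ ⊢ A → Ψ ⊢ A
  weaken Φ⊆Ψ (hyp A∈Φ) = hyp (Φ⊆Ψ A∈Φ)
  weaken Φ⊆Ψ (thm p)   = thm p
  weaken Φ⊆Ψ (mp d e)  = mp (weaken Φ⊆Ψ d) (weaken Φ⊆Ψ e)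

  deduction : ∀ {Φ A B} → A ∷ Φ ⊢ B → Φ ⊢ A ⇒ B
  deduction (hyp (here refl)) = thm (⇒-refl _)
  deduction (hyp (there B∈Φ)) = mp (thm (ax (cl-K _ _))) (hyp B∈Φ)
  deduction (thm p)           = mp (thm (ax (cl-K _ _))) (thm p)
  deduction (mp d e)          = mp (mp (thm (ax (cl-S _ _ _))) (deduction d)) (deduction e)

  ⇒-weaken : ∀ {Φ A B} → Φ ⊢ B → Φ ⊢ A ⇒ B
  ⇒-weaken {A = A} {B} d = mp (thm (ax (cl-K B A))) d

  explosion : ∀ {Φ A B} → Φ ⊢ A → Φ ⊢ ¬' A → Φ ⊢ B
  explosion {B = B} a ¬a = mp (thm (ax (cl-DNE B))) (⇒-weaken (mp ¬a a))

  ¬¬-elim : ∀ {Φ A} → Φ ⊢ ¬' (¬' A) → Φ ⊢ A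
  ¬¬-elim {A = A} d = mp (thm (ax (cl-DNE A))) d

  ¬-⇒ : ∀ {Φ A B} → Φ ⊢ ¬' A → Φ ⊢ A ⇒ B
  ¬-⇒ d = deduction (explosion (hyp (here refl)) (weaken there d))

  ∨-introˡ : ∀ {Φ A B} → Φ ⊢ A → Φ ⊢ A ∨' B
  ∨-introˡ d = deduction (explosion (weaken there d) (hyp (here refl)))

  ∧-intro : ∀ {Φ A B} → Φ ⊢ A → Φ ⊢ B → Φ ⊢ A ∧' B
  ∧-intro a b = deduction (mp (mp (hyp (here refl)) (weaken there a)) (weaken there b))

  ∧-elimˡ : ∀ {Φ A B} → Φ ⊢ A ∧' B → Φ ⊢ A
  ∧-elimˡ d = ¬¬-elim (deduction (mp (weaken there d) (¬-⇒ (hyp (here refl)))))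

  ∧-elimʳ : ∀ {Φ A B} → Φ ⊢ A ∧' B → Φ ⊢ B
  ∧-elimʳ d = ¬¬-elim (deduction (mp (weaken there d) (⇒-weaken (hyp (here refl)))))

  ⋀-intro : ∀ Φ → Φ ⊢ ⋀ Φ
  ⋀-intro []      = thm (⇒-refl ⊥')
  ⋀-intro (A ∷ Φ) = ∧-intro (hyp (here refl)) (weaken there (⋀-intro Φ))

  ⋀⇒-elim : ∀ {Φ B} → Prf L cs (⋀ Φ ⇒ B) → Φ ⊢ B
  ⋀⇒-elim {Φ} p = mp (thm p) (⋀-intro Φ)

  ⋀⇒-intro : ∀ {Φ B} → Φ ⊢ B → Prf L cs (⋀ Φ ⇒ B)
  ⋀⇒-intro {[]}    d = closed (⇒-weaken d)
  ⋀⇒-intro {A ∷ Φ} d =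
    closed (deduction (mp (mp (thm (⋀⇒-intro (deduction d))) (∧-elimʳ conj)) (∧-elimˡ conj)))
    where
      conj : A ∧' ⋀ Φ ∷ [] ⊢ A ∧' ⋀ Φ
      conj = hyp (here refl)

module Forgetful (em : ExcludedMiddle 0ℓ) (L : Logic) (cs : CS L) where

  ⟦_⟧ᶠ : Fm → Set
  ⟦ atom _ ⟧ᶠ = ⊤
  ⟦ ⊥' ⟧ᶠ     = ⊥
  ⟦ A ⇒ B ⟧ᶠ  = ⟦ A ⟧ᶠ → ⟦ B ⟧ᶠ
  ⟦ _ ∶ A ⟧ᶠ  = ⟦ A ⟧ᶠ

  axiom-sound : ∀ {A} → Axiom L A → ⟦ A ⟧ᶠ
  axiom-sound (cl-K A B)   = λ a _ → a
  axiom-sound (cl-S A B C) = λ f g a → f a (g a)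
  axiom-sound (cl-DNE A)   = decidable-stable em
  axiom-sound (j s t A B)  = λ f → f
  axiom-sound (j+ s t A)   = λ a∨a → decidable-stable em (λ ¬a → ¬a (a∨a ¬a))
  axiom-sound (j4 _ t A)   = λ a → a
  axiom-sound (jd _ t)     = λ ()
  axiom-sound (jt _ t A)   = λ a → a

  necF-sound : ∀ c A n → ⟦ A ⟧ᶠ → ⟦ necF c A n ⟧ᶠ
  necF-sound c A zero    a = a
  necF-sound c A (suc n) a = necF-sound c A n a

  sound : ∀ {A} → Prf L cs A → ⟦ A ⟧ᶠ
  sound (ax a)              = axiom-sound a
  sound (mp d e)            = sound d (sound e)
  sound (nec {c} {A} c∋A n) = necF-sound c A n (axiom-sound (onlyAxioms cs c A c∋A))

  ∅-consistent : Consistent L cs (λ _ → false)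
  ∅-consistent []      []      p = sound p (λ ())
  ∅-consistent (_ ∷ _) (() ∷ _)

module Maximal (em : ExcludedMiddle 0ℓ) (L : Logic) (cs : CS L) where

  open Hilbert L cs

  setOf : (Fm → Set) → FmSet
  setOf P F = does (em {P F})

  ∈-setOf⁺ : ∀ P {F} → P F → F ∈ˢ setOf P
  ∈-setOf⁺ P {F} = dec-true (em {P F})

  ∈-setOf⁻ : ∀ P {F} → F ∈ˢ setOf P → P F
  ∈-setOf⁻ P {F} F∈ with em {P F} | F∈
  ... | yes p | _ = p
  ... | no _  | ()

  ⊆ˢ-consistent : ∀ {Γ Δ} → Consistent L cs Δ → Γ ⊆ˢ Δ → Consistent L cs Γ
  ⊆ˢ-consistent con Γ⊆Δ Φ Φ⊆Γ = con Φ (All.map (Γ⊆Δ _) Φ⊆Γ)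

  ⊬⊥ : ∀ {Γ Φ} → Consistent L cs Γ → All (_∈ˢ Γ) Φ → ¬ (Φ ⊢ ⊥')
  ⊬⊥ con Φ⊆Γ d = con _ Φ⊆Γ (⋀⇒-intro d)

  infixl 25 _∪ᵖ_

  _∪ᵖ_ : FmSet → (Fm → Set) → FmSet
  Γ ∪ᵖ P = setOf (λ H → H ∈ˢ Γ ⊎ P H)

  ∈-∪ᵖ⁺ˡ : ∀ Γ P {H} → H ∈ˢ Γ → H ∈ˢ Γ ∪ᵖ P
  ∈-∪ᵖ⁺ˡ Γ P H∈Γ = ∈-setOf⁺ (λ H → H ∈ˢ Γ ⊎ P H) (inj₁ H∈Γ)

  ∈-∪ᵖ⁺ʳ : ∀ Γ P {H} → P H → H ∈ˢ Γ ∪ᵖ P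
  ∈-∪ᵖ⁺ʳ Γ P PH = ∈-setOf⁺ (λ H → H ∈ˢ Γ ⊎ P H) (inj₂ PH)

  ∈-∪ᵖ⁻ : ∀ Γ P {H} → H ∈ˢ Γ ∪ᵖ P → H ∈ˢ Γ ⊎ P H
  ∈-∪ᵖ⁻ Γ P = ∈-setOf⁻ (λ H → H ∈ˢ Γ ⊎ P H)

  ∪ᵖ-singleton-split : ∀ {G Γ} Φ → All (_∈ˢ Γ ∪ᵖ (_≡ G)) Φ → ∃[ Ψ ] All (_∈ˢ Γ) Ψ × Φ ⊆ G ∷ Ψ
  ∪ᵖ-singleton-split []      []         = [] , [] , λ ()
  ∪ᵖ-singleton-split {G} {Γ} (H ∷ Φ) (H∈ ∷ Φ⊆) with ∪ᵖ-singleton-split Φ Φ⊆ | ∈-∪ᵖ⁻ Γ (_≡ G) H∈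
  ... | Ψ , Ψ⊆Γ , Φ⊆G∷Ψ | inj₂ refl = Ψ , Ψ⊆Γ , ∈-∷⁺ʳ (here refl) Φ⊆G∷Ψ
  ... | Ψ , Ψ⊆Γ , Φ⊆G∷Ψ | inj₁ H∈Γ =
    H ∷ Ψ , H∈Γ ∷ Ψ⊆Γ , ∈-∷⁺ʳ (there (here refl)) (⊆-trans Φ⊆G∷Ψ (∷⁺ʳ _ (xs⊆x∷xs Ψ H)))

  MCS : FmSet → Set
  MCS = MaxConsistent L cs

  consistent-with⇒∈ : ∀ {Γ G} → MCS Γ → (∀ Ψ → All (_∈ˢ Γ) Ψ → ¬ (G ∷ Ψ ⊢ ⊥')) → G ∈ˢ Γ
  consistent-with⇒∈ {Γ} {G} (_ , maximal) G-consistent =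
    maximal (Γ ∪ᵖ (_≡ G)) (λ _ → ∈-∪ᵖ⁺ˡ Γ (_≡ G)) Γ∪G-consistent
      G (∈-∪ᵖ⁺ʳ Γ (_≡ G) refl)
    where
      Γ∪G-consistent : Consistent L cs (Γ ∪ᵖ (_≡ G))
      Γ∪G-consistent Φ Φ⊆ p with ∪ᵖ-singleton-split Φ Φ⊆
      ... | Ψ , Ψ⊆Γ , Φ⊆G∷Ψ = G-consistent Ψ Ψ⊆Γ (weaken Φ⊆G∷Ψ (⋀⇒-elim p))

  ⊢-∈ : ∀ {Γ Φ G} → MCS Γ → All (_∈ˢ Γ) Φ → Φ ⊢ G → G ∈ˢ Γ
  ⊢-∈ {Φ = Φ} mcs Φ⊆Γ d = consistent-with⇒∈ mcs λ Ψ Ψ⊆Γ refutation →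
    ⊬⊥ (proj₁ mcs) (++⁺ Φ⊆Γ Ψ⊆Γ)
      (mp (weaken (xs⊆ys++xs _ Φ) (deduction refutation)) (weaken (xs⊆xs++ys Φ _) d))

  Prf-∈ : ∀ {Γ A} → MCS Γ → Prf L cs A → A ∈ˢ Γ
  Prf-∈ mcs p = ⊢-∈ mcs [] (thm p)

  mp-∈ : ∀ {Γ A B} → MCS Γ → (A ⇒ B) ∈ˢ Γ → A ∈ˢ Γ → B ∈ˢ Γ
  mp-∈ mcs A⇒B∈Γ A∈Γ = ⊢-∈ mcs (A⇒B∈Γ ∷ A∈Γ ∷ []) (mp (hyp (here refl)) (hyp (there (here refl))))

  axiom-∈ : ∀ {Γ A B} → MCS Γ → Axiom L (A ⇒ B) → A ∈ˢ Γ → B ∈ˢ Γ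
  axiom-∈ mcs a = mp-∈ mcs (Prf-∈ mcs (ax a))

  ⊥-∉ : ∀ {Γ} → MCS Γ → Γ ⊥' ≡ false
  ⊥-∉ {Γ} mcs with Γ ⊥' in ⊥∈Γ
  ... | false = refl
  ... | true  = contradiction (hyp (here refl)) (⊬⊥ (proj₁ mcs) (⊥∈Γ ∷ []))

  ∉⇒¬∈ : ∀ {Γ F} → MCS Γ → Γ F ≡ false → (¬' F) ∈ˢ Γ
  ∉⇒¬∈ {Γ} {F} mcs F∉Γ = consistent-with⇒∈ mcs λ Ψ Ψ⊆Γ refutation →
    not-¬ F∉Γ (⊢-∈ mcs Ψ⊆Γ (¬¬-elim (deduction refutation)))

  module Lindenbaum (X : FmSet) (X-consistent : Consistent L cs X) where

    extend : FmSet → ℕ → FmSet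
    extend S n = S ∪ᵖ ((_≡ n) ∘ code)

    chain : ℕ → FmSet
    chain zero    = X
    chain (suc n) =
      if does (em {Consistent L cs (extend (chain n) n)}) then extend (chain n) n else chain n

    chain-consistent : ∀ n → Consistent L cs (chain n)
    chain-consistent zero    = X-consistent
    chain-consistent (suc n) with em {Consistent L cs (extend (chain n) n)}
    ... | yes consistent = consistent
    ... | no _           = chain-consistent n

    chain-⊆-suc : ∀ n → chain n ⊆ˢ chain (suc n)
    chain-⊆-suc n F F∈ with em {Consistent L cs (extend (chain n) n)}
    ... | yes _ = ∈-∪ᵖ⁺ˡ (chain n) ((_≡ n) ∘ code) F∈
    ... | no _  = F∈

    chain-mono : ∀ {m n} → m ≤′ n → chain m ⊆ˢ chain n
    chain-mono ≤′-refl        F F∈ = F∈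
    chain-mono (≤′-step m≤n) F F∈ = chain-⊆-suc _ F (chain-mono m≤n F F∈)

    Reached : Fm → Set
    Reached G = ∃[ n ] G ∈ˢ chain n

    limit : FmSet
    limit = setOf Reached

    finite-⊆-chain : ∀ Φ → All (_∈ˢ limit) Φ → ∃[ N ] All (_∈ˢ chain N) Φ
    finite-⊆-chain []      []         = 0 , []
    finite-⊆-chain (G ∷ Φ) (G∈ ∷ Φ⊆) with ∈-setOf⁻ Reached G∈ | finite-⊆-chain Φ Φ⊆
    ... | m , G∈m | N , Φ⊆N =
      m ⊔ N , chain-mono (≤⇒≤′ (m≤m⊔n m N)) G G∈m ∷ All.map (chain-mono (≤⇒≤′ (m≤n⊔m m N)) _) Φ⊆N

    limit-consistent : Consistent L cs limit
    limit-consistent Φ Φ⊆ with finite-⊆-chain Φ Φ⊆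
    ... | N , Φ⊆N = chain-consistent N Φ Φ⊆N

    limit-maximal : ∀ Δ → limit ⊆ˢ Δ → Consistent L cs Δ → Δ ⊆ˢ limit
    limit-maximal Δ limit⊆Δ Δ-consistent F F∈Δ = ∈-setOf⁺ Reached (suc (code F) , F∈next)
      where
        extend⊆Δ : extend (chain (code F)) (code F) ⊆ˢ Δ
        extend⊆Δ G G∈ with ∈-∪ᵖ⁻ (chain (code F)) ((_≡ code F) ∘ code) G∈
        ... | inj₁ G∈chain = limit⊆Δ G (∈-setOf⁺ Reached (code F , G∈chain))
        ... | inj₂ same-code with refl ← code-injective {G} {F} same-code = F∈Δ

        F∈next : F ∈ˢ chain (suc (code F))
        F∈next with em {Consistent L cs (extend (chain (code F)) (code F))}
        ... | yes _            = ∈-∪ᵖ⁺ʳ (chain (code F)) ((_≡ code F) ∘ code) refl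
        ... | no ¬consistent = contradiction (⊆ˢ-consistent Δ-consistent extend⊆Δ) ¬consistent

  lindenbaum : ∀ X → Consistent L cs X → ∃[ Δ ] MCS Δ × X ⊆ˢ Δ
  lindenbaum X X-consistent =
    limit , (limit-consistent , limit-maximal) , λ F F∈X → ∈-setOf⁺ Reached (0 , F∈X)
    where open Lindenbaum X X-consistent

module Canonical (em : ExcludedMiddle 0ℓ) (L : Logic) (cs : CS L) where

  open Hilbert L cs
  open Maximal em L cs public

  MCS-exists : ∃[ Γ ] MCS Γ
  MCS-exists = let Γ , mcs , _ = lindenbaum _ (Forgetful.∅-consistent em L cs) in Γ , mcs

  ⇒-∈⁻ : ∀ {Γ F G} → MCS Γ → (F ⇒ G) ∈ˢ Γ → Γ F ≡ false ⊎ G ∈ˢ Γ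
  ⇒-∈⁻ {Γ} {F} mcs F⇒G∈Γ with Γ F in F∈Γ
  ... | false = inj₁ refl
  ... | true  = inj₂ (mp-∈ mcs F⇒G∈Γ F∈Γ)

  ⇒-∈⁺ : ∀ {Γ F G} → MCS Γ → Γ F ≡ false ⊎ G ∈ˢ Γ → (F ⇒ G) ∈ˢ Γ
  ⇒-∈⁺ mcs (inj₁ F∉Γ) = ⊢-∈ mcs (∉⇒¬∈ mcs F∉Γ ∷ []) (¬-⇒ (hyp (here refl)))
  ⇒-∈⁺ mcs (inj₂ G∈Γ) = ⊢-∈ mcs (G∈Γ ∷ []) (⇒-weaken (hyp (here refl)))

  infixl 25 _/_

  _/_ : FmSet → Tm → FmSet
  (Γ / t) F = Γ (t ∶ F)

  ∶-∈-of-E : ∀ Γ t {F} → (∀ Δ → Eᶜ Γ t Δ → F ∈ˢ Δ) → (t ∶ F) ∈ˢ Γ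
  ∶-∈-of-E Γ t F∈E = F∈E (Γ / t) (λ _ F∈ → F∈)

  E-·-APP : ∀ {Γ s t Δ F} → MCS Γ → Eᶜ Γ (s · t) Δ → APP Vᶜ Eᶜ Γ s t F → F ∈ˢ Δ
  E-·-APP {Γ} {s} {t} {F = F} mcs Δ∈E (H , E⊆H⇒F , E⊆H) =
    Δ∈E F (mp-∈ mcs (axiom-∈ mcs (j s t H F) (∶-∈-of-E Γ s E⊆H⇒F)) (∶-∈-of-E Γ t E⊆H))

  E-+ˡ : ∀ {Γ s t Δ} → MCS Γ → Eᶜ Γ (s +ₜ t) Δ → Eᶜ Γ s Δ
  E-+ˡ {s = s} {t} mcs Δ∈E F s∶F∈Γ =
    Δ∈E F (⊢-∈ mcs (s∶F∈Γ ∷ []) (mp (thm (ax (j+ s t F))) (∨-introˡ (hyp (here refl)))))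

  E-+ʳ : ∀ {Γ s t Δ} → MCS Γ → Eᶜ Γ (s +ₜ t) Δ → Eᶜ Γ t Δ
  E-+ʳ {s = s} {t} mcs Δ∈E F t∶F∈Γ =
    Δ∈E F (⊢-∈ mcs (t∶F∈Γ ∷ []) (mp (thm (ax (j+ s t F))) (⇒-weaken (hyp (here refl)))))

  E-! : hasJ4 L ≡ true → ∀ {Γ t Δ} → MCS Γ → Eᶜ Γ (! t) Δ → ∀ F → (t ∶ F) ∈ˢ Γ → (t ∶ F) ∈ˢ Δ
  E-! j4∈L {t = t} mcs Δ∈E F t∶F∈Γ = Δ∈E (t ∶ F) (axiom-∈ mcs (j4 j4∈L t F) t∶F∈Γ)

  E-reflexive : hasJT L ≡ true → ∀ {Γ} → MCS Γ → ∀ t → Eᶜ Γ t Γ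
  E-reflexive jt∈L mcs t F = axiom-∈ mcs (jt jt∈L t F)

  internalize : AxiomaticallyAppropriate cs → ∀ {A} → Prf L cs A → ∃[ s ] Prf L cs (s ∶ A)
  internalize aa (ax {A} a)          = let c , c∋A = aa A a in cst c , nec c∋A 0
  internalize aa (nec {c} c∋A n)     = bang (suc n) (cst c) , nec c∋A (suc n)
  internalize aa (mp {A} {B} d e)
    with s , ⊢s∶A⇒B ← internalize aa d
       | u , ⊢u∶A   ← internalize aa e = s · u , mp (mp (ax (j s u A B)) ⊢s∶A⇒B) ⊢u∶A

  lift : AxiomaticallyAppropriate cs → ∀ {Γ t Φ B} → MCS Γ →
         All (_∈ˢ Γ / t) Φ → Φ ⊢ B → ∃[ s ] (s ∶ B) ∈ˢ Γ
  lift aa {t = t} mcs Φ⊆Γ/t (hyp B∈Φ) = t , All.lookup Φ⊆Γ/t B∈Φ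
  lift aa mcs Φ⊆Γ/t (thm p) = let s , ⊢s∶B = internalize aa p in s , Prf-∈ mcs ⊢s∶B
  lift aa mcs Φ⊆Γ/t (mp {A} {B} d e)
    with s , s∶A⇒B ← lift aa mcs Φ⊆Γ/t d
       | u , u∶A   ← lift aa mcs Φ⊆Γ/t e = s · u , mp-∈ mcs (axiom-∈ mcs (j s u A B) s∶A⇒B) u∶A

  /-consistent : hasJD L ≡ true → AxiomaticallyAppropriate cs → ∀ {Γ} t → MCS Γ →
                 Consistent L cs (Γ / t)
  /-consistent jd∈L aa t mcs Φ Φ⊆Γ/t p =
    let s , s∶⊥ = lift aa mcs Φ⊆Γ/t (⋀⇒-elim p)
    in not-¬ (⊥-∉ mcs) (axiom-∈ mcs (jd jd∈L s) s∶⊥)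

  E-serial : hasJD L ≡ false ⊎ (hasJD L ≡ true × (AxiomaticallyAppropriate cs ⊎ hasJT L ≡ true)) →
             hasJD L ≡ true → ∀ {Γ} → MCS Γ → ∀ t → ∃[ Δ ] MCS Δ × Eᶜ Γ t Δ
  E-serial (inj₁ jd∉L) jd∈L with () ← trans (sym jd∈L) jd∉L
  E-serial (inj₂ (_ , inj₂ jt∈L)) _ mcs t = _ , mcs , E-reflexive jt∈L mcs t
  E-serial (inj₂ (_ , inj₁ aa)) jd∈L mcs t = lindenbaum _ (/-consistent jd∈L aa t mcs)

mainTheorem10 : ExcludedMiddle 0ℓ → (L : Logic) → (cs : CS L) →
    (hasJD L ≡ false ⊎ (hasJD L ≡ true × (AxiomaticallyAppropriate cs ⊎ hasJT L ≡ true))) →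
    IsSubsetModel L cs Wᶜ (W₀ᶜ L cs) Vᶜ Eᶜ
mainTheorem10 em L cs condition = record
  { W₀-nonempty = MCS-exists
  ; V-⊥   = λ _ → ⊥-∉
  ; V-⇒₁  = λ _ mcs _ _ → ⇒-∈⁻ mcs
  ; V-⇒₂  = λ _ mcs _ _ → ⇒-∈⁺ mcs
  ; V-∶₁  = λ _ _ _ F t∶F∈Γ _ Δ∈E → Δ∈E F t∶F∈Γ
  ; V-∶₂  = λ Γ _ t _ → ∶-∈-of-E Γ t
  ; E-·   = λ _ mcs _ _ _ Δ∈E _ → E-·-APP mcs Δ∈E
  ; E-+   = λ _ mcs _ _ _ Δ∈E → E-+ˡ mcs Δ∈E , E-+ʳ mcs Δ∈E
  ; E-jd  = λ jd∈L _ → E-serial condition jd∈L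
  ; E-jt  = λ jt∈L _ → E-reflexive jt∈L
  ; E-j4  = λ j4∈L _ mcs _ _ → E-! j4∈L mcs
  ; E-cs  = λ _ mcs _ A c∋A _ Δ∈E → Δ∈E A (Prf-∈ mcs (nec c∋A 0))
  ; E-cs! = λ _ mcs c A c∋A n _ Δ∈E → Δ∈E (necF c A n) (Prf-∈ mcs (nec c∋A (suc n)))
  }
  where open Canonical em L cs
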